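{- Let $\Phi$ be an irreducible crystallographic root system, $k$ a positive integer, $\mathcal{I}=(I_1,\ldots,I_k)$ a geometric chain of $k$ ideals in the root poset of $\Phi$, and $\alpha\in\Phi^+$. If $\alpha\in\langle\mathsf{supp}(\mathcal{I})\rangle_{\mathbb{N}}$, then $r_\alpha(\underline{\mathcal{I}})=r_\alpha(\mathcal{I})$. In particular, if $r_\alpha(\underline{\mathcal{I}})\le k$, then $r_\alpha(\underline{\mathcal{I}})=r_\alpha(\mathcal{I})$.
   Context: $S$ is the simple system and $\Phi^+$ the positive system. Root poset: $\alpha\le\beta$ iff $\beta-\alpha$ is a nonnegative integer combination of $S$; ideals are down-closed subsets of $\Phi^+$. An ascending chain of ideals $I_1\subseteq\cdots\subseteq I_k$ with $J_i=\Phi^+\setminus I_i$ is geometric if $(I_i+I_j)\cap\Phi^+\subseteq I_{i+j}$ for $i+j\le k$ and $(J_i+J_j)\cap\Phi^+\subseteq J_{i+j}$ for $i,j\in\{0,\ldots,k\}$, with $I_0=\varnothing$, $J_0=\Phi^+$, $J_i=J_k$ for $i>k$. $\mathsf{supp}(\mathcal{I})=I_k\cap S$, and $\langle X\rangle_{\mathbb{N}}$ denotes the set of nonnegative integer combinations of $X$. For a chain of ideals $\mathcal{I}=(I_1,\ldots,I_p)$ and $\alpha\in\Phi^+$, $r_\alpha(\mathcal{I})=\min\{r_1+\cdots+r_m\mid\alpha=\alpha_1+\cdots+\alpha_m,\ \alpha_i\in I_{r_i}\}$, or $\infty$ if no decomposition exists. $\underline{\mathcal{I}}=(\underline{I}_1,\ldots,\underline{I}_{k+1})$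 with $\underline{I}_i=I_i$ for $i\in[k]$ and $\underline{I}_{k+1}=\bigcup_{i+j=k+1}((I_i+I_j)\cap\Phi^+)\cup I_k\cup S$. -}

module Defs where

open import Data.Nat as ℕ using (ℕ; zero; suc; _⊓_)
open import Data.Integer as ℤ using (ℤ; +_; 0ℤ)
open import Data.Rational as ℚ using (ℚ; 0ℚ)
open import Data.Fin using (Fin)
open import Data.Vec using (Vec; []; _∷_; zipWith; map; replicate; lookup; foldr; _[_]≔_)
open import Data.Vec.Relation.Unary.All using (All)
open import Data.List using (List)
import Data.List as L
open import Data.List.Relation.Unary.All as LAll using ()
open import Data.List.Membership.Propositional using (_∈_)
open import Data.Product using (Σ; ∃; ∃-syntax; _×_; _,_)
open import Data.Sum using (_⊎_)
open import Data.Bool using (Bool; true; false)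
open import Data.Maybe using (Maybe; just; nothing)
open import Data.Nat.ListAction using () renaming (sum to sumℕ)
open import Data.Empty using (⊥)
open import Relation.Nullary using (¬_)
open import Relation.Binary.PropositionalEquality using (_≡_; _≢_)

-- Vectors in ℤ^n : coordinates with respect to the simple system S = {e_1,…,e_n}
-- (every root system with a chosen simple system is isomorphic to one of this form).
Vecℤ : ℕ → Set
Vecℤ n = Vec ℤ n

infixl 6 _⊕_ _⊖_
_⊕_ : ∀ {n} → Vecℤ n → Vecℤ n → Vecℤ n
_⊕_ = zipWith ℤ._+_

_⊖_ : ∀ {n} → Vecℤ n → Vecℤ n → Vecℤ n
_⊖_ = zipWith ℤ._-_

infixr 7 _·_
_·_ : ∀ {n} → ℤ → Vecℤ n → Vecℤ n
c · v = map (c ℤ.*_) v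

zeroV : ∀ {n} → Vecℤ n
zeroV = replicate _ 0ℤ

e : ∀ {n} → Fin n → Vecℤ n
e i = zeroV [ i ]≔ + 1

toℚ : ℤ → ℚ
toℚ z = z ℚ./ 1

dotℚ : ∀ {n} → Vec ℚ n → Vec ℚ n → ℚ
dotℚ u v = foldr _ ℚ._+_ 0ℚ (zipWith ℚ._*_ u v)

formℚ : ∀ {n} → Vec (Vec ℚ n) n → Vec ℚ n → Vec ℚ n → ℚ
formℚ B x y = dotℚ x (map (λ row → dotℚ row y) B)

form : ∀ {n} → Vec (Vec ℚ n) n → Vecℤ n → Vecℤ n → ℚ
form B x y = formℚ B (map toℚ x) (map toℚ y)

sumV : ∀ {n} → List (Vecℤ n) → Vecℤ n
sumV = L.foldr _⊕_ zeroV

-- ⟨X⟩_ℕ : nonnegative integer combinations (= finite sums, with repetition) of elements of X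
⟨_⟩ℕ : ∀ {n} → (Vecℤ n → Set) → Vecℤ n → Set
⟨ X ⟩ℕ α = Σ (List _) λ L → LAll.All X L × sumV L ≡ α

IsSimple : ∀ {n} → Vecℤ n → Set
IsSimple {n} v = ∃[ i ] v ≡ e {n} i

-- An irreducible (reduced) crystallographic root system Φ in ℚ^n, with simple
-- system S = {e_1,…,e_n} (standard basis), and a W-invariant positive definite
-- symmetric form B.
record IrredCrystRootSystem (n : ℕ) : Set where
  field
    nonempty : 1 ℕ.≤ n
    Φ : List (Vecℤ n)
    B : Vec (Vec ℚ n) n
    B-sym : ∀ i j → lookup (lookup B i) j ≡ lookup (lookup B j) i
    B-posdef : ∀ (x : Vec ℚ n) → x ≢ replicate n 0ℚ → 0ℚ ℚ.< formℚ B x x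
    zero∉Φ : ¬ (zeroV ∈ Φ)
    reduced : ∀ α β → α ∈ Φ → β ∈ Φ → ∀ (p q : ℤ) → p · α ≡ q · β →
              p ≡ q ⊎ p ≡ ℤ.- q
    -- crystallographic and stable under reflections:
    -- 2(β,α)/(α,α) = c ∈ ℤ and s_α(β) = β - c α ∈ Φ
    cryst : ∀ α β → α ∈ Φ → β ∈ Φ →
            ∃[ c ] ((toℚ (+ 2) ℚ.* form B β α ≡ toℚ c ℚ.* form B α α) ×
                    (β ⊖ c · α) ∈ Φ)
    -- S is a simple system: S ⊆ Φ (S is a basis of ℚ^n automatically), and every
    -- root is a nonnegative or nonpositive integer combination of S
    simple∈Φ : ∀ i → e i ∈ Φ
    simple-sign : ∀ α → α ∈ Φ → ⟨ IsSimple ⟩ℕ α ⊎ ⟨ IsSimple ⟩ℕ (ℤ.-1ℤ · α)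
    irreducible : ∀ (P : Vecℤ n → Bool) →
      (∀ α β → α ∈ Φ → β ∈ Φ → P α ≡ true → P β ≡ false → form B α β ≡ 0ℚ) →
      (∀ α → α ∈ Φ → P α ≡ true) ⊎ (∀ α → α ∈ Φ → P α ≡ false)

module _ {n : ℕ} (R : IrredCrystRootSystem n) where
  open IrredCrystRootSystem R

  Pos : Vecℤ n → Set
  Pos α = α ∈ Φ × ⟨ IsSimple ⟩ℕ α

  _≼_ : Vecℤ n → Vecℤ n → Set
  α ≼ β = ⟨ IsSimple ⟩ℕ (β ⊖ α)

  IsIdeal : (Vecℤ n → Bool) → Set
  IsIdeal I = (∀ α → I α ≡ true → Pos α) ×
              (∀ α β → Pos α → α ≼ β → I β ≡ true → I α ≡ true)

  -- A chain of k ideals is a family I : ℕ → subsets, of which I 1 … I k are used.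
  Chain : Set
  Chain = ℕ → Vecℤ n → Bool

  -- I_i with conventions I_0 = ∅ and I_i = I_k for i > k
  Iext : ℕ → Chain → ℕ → Vecℤ n → Set
  Iext k I zero α = ⊥
  Iext k I (suc i) α = I (suc i ⊓ k) α ≡ true

  Jext : ℕ → Chain → ℕ → Vecℤ n → Set
  Jext k I i α = Pos α × ¬ Iext k I i α

  IsAscendingIdealChain : ℕ → Chain → Set
  IsAscendingIdealChain k I =
    (∀ i → 1 ℕ.≤ i → i ℕ.≤ k → IsIdeal (I i)) ×
    (∀ i → 1 ℕ.≤ i → i ℕ.< k → ∀ α → I i α ≡ true → I (suc i) α ≡ true)

  IsGeometric : ℕ → Chain → Set
  IsGeometric k I =
    IsAscendingIdealChain k I ×
    (∀ i j → 1 ℕ.≤ i → 1 ℕ.≤ j → i ℕ.+ j ℕ.≤ k → ∀ α β →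
       I i α ≡ true → I j β ≡ true → Pos (α ⊕ β) → I (i ℕ.+ j) (α ⊕ β) ≡ true) ×
    (∀ i j → i ℕ.≤ k → j ℕ.≤ k → ∀ α β →
       Jext k I i α → Jext k I j β → Pos (α ⊕ β) → Jext k I (i ℕ.+ j) (α ⊕ β))

  Supp : ℕ → Chain → Vecℤ n → Set
  Supp k I α = IsSimple α × I k α ≡ true

  Decomp : (ℕ → Vecℤ n → Set) → ℕ → Vecℤ n → ℕ → Set
  Decomp P p α s =
    Σ (List (Vecℤ n × ℕ)) λ L →
      LAll.All (λ { (β , r) → 1 ℕ.≤ r × r ℕ.≤ p × P r β }) L ×
      sumV (L.map Data.Product.proj₁ L) ≡ α ×
      sumℕ (L.map Data.Product.proj₂ L) ≡ s

  -- r_α(P) = v  (v = nothing means r_α = ∞)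
  RankIs : (ℕ → Vecℤ n → Set) → ℕ → Vecℤ n → Maybe ℕ → Set
  RankIs P p α (just s) = Decomp P p α s × (∀ s' → Decomp P p α s' → s ℕ.≤ s')
  RankIs P p α nothing = ∀ s → ¬ Decomp P p α s

  AsSet : Chain → ℕ → Vecℤ n → Set
  AsSet I i α = I i α ≡ true

  Under : ℕ → Chain → ℕ → Vecℤ n → Set
  Under k I i α =
    (i ℕ.≤ k × I i α ≡ true) ⊎
    (i ≡ suc k ×
      ((∃[ a ] ∃[ b ] ∃[ β ] ∃[ γ ] (1 ℕ.≤ a × 1 ℕ.≤ b × a ℕ.+ b ≡ suc k ×
          I a β ≡ true × I b γ ≡ true × β ⊕ γ ≡ α × Pos α))
       ⊎ I k α ≡ true ⊎ IsSimple α))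

-- Every member of the extended chain is a nonnegative combination of simple roots, so in a
-- decomposition of α ∈ ⟨supp 𝓘⟩ℕ each summand is supported on supp 𝓘. A summand of the new
-- level I̲_{k+1} is then either a root of I_k (or a simple root of supp 𝓘 ⊆ I_k), which can be
-- reassigned weight k, or a sum β + γ with β ∈ I_a, γ ∈ I_b, a + b = k + 1, which can be split
-- at no cost. Hence 𝓘̲ admits no cheaper decompositions than 𝓘; and a decomposition of weight
-- at most k never uses level k + 1 at all.
module Submission where

open import Defs
open import Data.Nat using (ℕ; suc; _≤_)
open import Data.Maybe using (Maybe; just; nothing)
open import Data.Product using (_×_)
open import Function.Bundles using (_⇔_)

open import Data.Nat as ℕ using (z≤n; _+_)
import Data.Nat.Properties as ℕ
open import Data.Nat.ListAction using () renaming (sum to sumℕ)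
open import Data.Nat.ListAction.Properties using () renaming (sum-++ to sumℕ-++)
open import Data.Integer as ℤ using (+_; 0ℤ)
import Data.Integer.Properties as ℤ
open import Data.Fin using (Fin)
import Data.Fin.Properties as Fin
open import Data.Vec using (lookup)
import Data.Vec.Properties as Vec
open import Data.List using (List; []; _∷_; _++_; [_])
import Data.List as List
import Data.List.Properties as List
open import Data.List.Relation.Unary.All as All using (All; []; _∷_)
open import Data.List.Relation.Unary.All.Properties using (++⁺; gmap⁺)
open import Data.Product using (Σ; ∃-syntax; _,_; proj₁; proj₂)
open import Data.Sum using (inj₁; inj₂)
open import Data.Bool using (Bool; true; false)
open import Data.Empty using (⊥-elim)
open import Relation.Nullary using (yes; no)
open import Relation.Binary.PropositionalEquality hiding ([_])
open import Function.Bundles using (mk⇔)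

private variable
  n : ℕ

m+n≡1+k⇒m≤k : ∀ m {n k} → 1 ≤ n → m + n ≡ suc k → m ≤ k
m+n≡1+k⇒m≤k m {suc n} _ eq =
  subst (m ≤_) (ℕ.suc-injective (trans (sym (ℕ.+-suc m n)) eq)) (ℕ.m≤m+n m n)

m+n≡1+k⇒n≤k : ∀ {m} n {k} → 1 ≤ m → m + n ≡ suc k → n ≤ k
m+n≡1+k⇒n≤k {m} n 1≤m eq = m+n≡1+k⇒m≤k n 1≤m (trans (ℕ.+-comm n m) eq)

nonNegative-+≡0 : ∀ {a b} → 0ℤ ℤ.≤ a → 0ℤ ℤ.≤ b → a ℤ.+ b ≡ 0ℤ → a ≡ 0ℤ × b ≡ 0ℤ
nonNegative-+≡0 {+ a} {+ b} _ _ eq =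
  cong +_ (ℕ.m+n≡0⇒m≡0 a a+b≡0) , cong +_ (ℕ.m+n≡0⇒n≡0 a a+b≡0)
  where a+b≡0 = ℤ.+-injective eq

lookup-⊕ : (u v : Vecℤ n) (i : Fin n) → lookup (u ⊕ v) i ≡ lookup u i ℤ.+ lookup v i
lookup-⊕ u v i = Vec.lookup-zipWith ℤ._+_ i u v

lookup-zeroV : (i : Fin n) → lookup (zeroV {n}) i ≡ 0ℤ
lookup-zeroV i = Vec.lookup-replicate i 0ℤ

lookup-e-≡ : (i : Fin n) → lookup (e i) i ≡ + 1
lookup-e-≡ i = Vec.lookup∘update i zeroV (+ 1)

lookup-e-≢ : {i j : Fin n} → i ≢ j → lookup (e j) i ≡ 0ℤ
lookup-e-≢ {i = i} i≢j = trans (Vec.lookup∘update′ i≢j zeroV (+ 1)) (lookup-zeroV i)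

⊕-identityˡ : (v : Vecℤ n) → zeroV ⊕ v ≡ v
⊕-identityˡ = Vec.zipWith-identityˡ ℤ.+-identityˡ

⊕-identityʳ : (v : Vecℤ n) → v ⊕ zeroV ≡ v
⊕-identityʳ = Vec.zipWith-identityʳ ℤ.+-identityʳ

⊕-assoc : (u v w : Vecℤ n) → (u ⊕ v) ⊕ w ≡ u ⊕ (v ⊕ w)
⊕-assoc = Vec.zipWith-assoc ℤ.+-assoc

sumV-++ : (xs ys : List (Vecℤ n)) → sumV (xs ++ ys) ≡ sumV xs ⊕ sumV ys
sumV-++ []       ys = sym (⊕-identityˡ (sumV ys))
sumV-++ (x ∷ xs) ys = begin
  x ⊕ sumV (xs ++ ys)        ≡⟨ cong (x ⊕_) (sumV-++ xs ys) ⟩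
  x ⊕ (sumV xs ⊕ sumV ys)    ≡⟨ ⊕-assoc x (sumV xs) (sumV ys) ⟨
  (x ⊕ sumV xs) ⊕ sumV ys    ∎
  where open ≡-Reasoning

NonNegative : Vecℤ n → Set
NonNegative v = ∀ i → 0ℤ ℤ.≤ lookup v i

zeroV-nonNegative : NonNegative (zeroV {n})
zeroV-nonNegative i rewrite lookup-zeroV i = ℤ.+≤+ z≤n

⊕-nonNegative : {u v : Vecℤ n} → NonNegative u → NonNegative v → NonNegative (u ⊕ v)
⊕-nonNegative {u = u} {v} u≥0 v≥0 i rewrite lookup-⊕ u v i = ℤ.+-mono-≤ (u≥0 i) (v≥0 i)

e-nonNegative : (j : Fin n) → NonNegative (e j)
e-nonNegative j i with i Fin.≟ j
... | yes refl rewrite lookup-e-≡ i = ℤ.+≤+ z≤n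
... | no i≢j   rewrite lookup-e-≢ i≢j = ℤ.+≤+ z≤n

simple-nonNegative : {v : Vecℤ n} → IsSimple v → NonNegative v
simple-nonNegative (j , refl) = e-nonNegative j

sumV-nonNegative : {xs : List (Vecℤ n)} → All NonNegative xs → NonNegative (sumV xs)
sumV-nonNegative []                 = zeroV-nonNegative
sumV-nonNegative {xs = x ∷ xs} (x≥0 ∷ xs≥0) =
  ⊕-nonNegative {u = x} {v = sumV xs} x≥0 (sumV-nonNegative xs≥0)

⟨IsSimple⟩ℕ⇒nonNegative : {v : Vecℤ n} → ⟨ IsSimple ⟩ℕ v → NonNegative v
⟨IsSimple⟩ℕ⇒nonNegative (_ , simple , refl) =
  sumV-nonNegative (All.map simple-nonNegative simple)

VanishesOff : (Vecℤ n → Bool) → Vecℤ n → Set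
VanishesOff X v = ∀ i → X (e i) ≡ false → lookup v i ≡ 0ℤ

vanishesOff-⊕⁻ : ∀ {X} {u v : Vecℤ n} → NonNegative u → NonNegative v →
                 VanishesOff X (u ⊕ v) → VanishesOff X u × VanishesOff X v
vanishesOff-⊕⁻ {X = X} {u = u} {v} u≥0 v≥0 vanish =
  (λ i off → proj₁ (split i off)) , (λ i off → proj₂ (split i off))
  where
  split : ∀ i → X (e i) ≡ false → lookup u i ≡ 0ℤ × lookup v i ≡ 0ℤ
  split i off = nonNegative-+≡0 (u≥0 i) (v≥0 i) (trans (sym (lookup-⊕ u v i)) (vanish i off))

vanishesOff-e⇒∈ : ∀ {X} (j : Fin n) → VanishesOff X (e j) → X (e j) ≡ true
vanishesOff-e⇒∈ {X = X} j vanish with X (e j) in eq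
... | true  = refl
... | false with trans (sym (lookup-e-≡ j)) (vanish j eq)
...   | ()

sumV-vanishesOff : ∀ {X} {xs : List (Vecℤ n)} →
  All (λ w → IsSimple w × X w ≡ true) xs → VanishesOff X (sumV xs)
sumV-vanishesOff [] i _ = lookup-zeroV i
sumV-vanishesOff {xs = _ ∷ xs} (((j , refl) , j∈X) ∷ ps) i i∉X = begin
  lookup (e j ⊕ sumV xs) i              ≡⟨ lookup-⊕ (e j) (sumV xs) i ⟩
  lookup (e j) i ℤ.+ lookup (sumV xs) i ≡⟨ cong₂ ℤ._+_ head-vanishes (sumV-vanishesOff ps i i∉X) ⟩
  0ℤ                                    ∎
  where
  open ≡-Reasoning
  head-vanishes : lookup (e j) i ≡ 0ℤ
  head-vanishes with i Fin.≟ j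
  ... | no i≢j = lookup-e-≢ i≢j
  ... | yes refl with trans (sym j∈X) i∉X
  ...   | ()

⟨Simple∩⟩ℕ⇒vanishesOff : ∀ {X} {v : Vecℤ n} →
  ⟨ (λ w → IsSimple w × X w ≡ true) ⟩ℕ v → VanishesOff X v
⟨Simple∩⟩ℕ⇒vanishesOff {X = X} (_ , simple , sum≡v) =
  subst (VanishesOff X) sum≡v (sumV-vanishesOff simple)

Part : (ℕ → Vecℤ n → Set) → ℕ → Vecℤ n × ℕ → Set
Part P p (β , r) = 1 ≤ r × r ≤ p × P r β

sums : List (Vecℤ n × ℕ) → Vecℤ n
sums L = sumV (List.map proj₁ L)

weight : List (Vecℤ n × ℕ) → ℕ
weight L = sumℕ (List.map proj₂ L)

sums-++ : (L M : List (Vecℤ n × ℕ)) → sums (L ++ M) ≡ sums L ⊕ sums M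
sums-++ L M =
  trans (cong sumV (List.map-++ proj₁ L M)) (sumV-++ (List.map proj₁ L) (List.map proj₁ M))

weight-++ : (L M : List (Vecℤ n × ℕ)) → weight (L ++ M) ≡ weight L + weight M
weight-++ L M =
  trans (cong sumℕ (List.map-++ proj₂ L M)) (sumℕ-++ (List.map proj₂ L) (List.map proj₂ M))

module _ (R : IrredCrystRootSystem n) {P Q : ℕ → Vecℤ n → Set} {p q : ℕ} {α : Vecℤ n} where

  rankIs-⇔ : (∀ {s} → Decomp R Q q α s → Decomp R P p α s) →
             (∀ {s} → Decomp R P p α s → ∃[ s' ] s' ≤ s × Decomp R Q q α s') →
             ∀ v → RankIs R P p α v ⇔ RankIs R Q q α v
  rankIs-⇔ Q⇒P P⇒Q (just s) = mk⇔ to from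
    where
    to : RankIs R P p α (just s) → RankIs R Q q α (just s)
    to (d , minimal) with P⇒Q d
    ... | s' , s'≤s , d' =
      subst (Decomp R Q q α) (ℕ.≤-antisym s'≤s (minimal s' (Q⇒P d'))) d' ,
      λ s'' d'' → minimal s'' (Q⇒P d'')
    from : RankIs R Q q α (just s) → RankIs R P p α (just s)
    from (d , minimal) = Q⇒P d , λ s'' d'' →
      let (s' , s'≤s'' , d') = P⇒Q d'' in ℕ.≤-trans (minimal s' d') s'≤s''
  rankIs-⇔ Q⇒P P⇒Q nothing =
    mk⇔ (λ none s d → none s (Q⇒P d))
        (λ none s d → let (s' , _ , d') = P⇒Q d in none s' d')

  rankIs-transfer : ∀ {s} → (∀ {s'} → Decomp R Q q α s' → Decomp R P p α s') →
                    (Decomp R P p α s → Decomp R Q q α s) →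
                    RankIs R P p α (just s) → RankIs R Q q α (just s)
  rankIs-transfer Q⇒P P⇒Q (d , minimal) = P⇒Q d , λ s' d' → minimal s' (Q⇒P d')

module Refinement (R : IrredCrystRootSystem n) (k : ℕ) (1≤k : 1 ≤ k) (I : Chain R)
  (I⊆Φ⁺ : ∀ i → 1 ≤ i → i ≤ k → ∀ β → I i β ≡ true → Pos R β) where

  UnderPart : Vecℤ n × ℕ → Set
  UnderPart = Part (Under R k I) (suc k)

  ChainPart : Vecℤ n × ℕ → Set
  ChainPart = Part (AsSet R I) k

  ∈I⇒nonNegative : ∀ {i β} → 1 ≤ i → i ≤ k → I i β ≡ true → NonNegative β
  ∈I⇒nonNegative 1≤i i≤k β∈I = ⟨IsSimple⟩ℕ⇒nonNegative (proj₂ (I⊆Φ⁺ _ 1≤i i≤k _ β∈I))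

  underPart-nonNegative : ∀ {β r} → UnderPart (β , r) → NonNegative β
  underPart-nonNegative (1≤r , _ , inj₁ (r≤k , β∈I)) = ∈I⇒nonNegative 1≤r r≤k β∈I
  underPart-nonNegative (_ , _ , inj₂ (_ , inj₁ (_ , _ , _ , _ , _ , _ , _ , _ , _ , _ , β∈Φ⁺))) =
    ⟨IsSimple⟩ℕ⇒nonNegative (proj₂ β∈Φ⁺)
  underPart-nonNegative (_ , _ , inj₂ (_ , inj₂ (inj₁ β∈Iₖ))) = ∈I⇒nonNegative 1≤k ℕ.≤-refl β∈Iₖ
  underPart-nonNegative (_ , _ , inj₂ (_ , inj₂ (inj₂ β-simple))) = simple-nonNegative β-simple

  sums-nonNegative : ∀ {L} → All UnderPart L → NonNegative (sums L)
  sums-nonNegative parts =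
    sumV-nonNegative (gmap⁺ underPart-nonNegative parts)

  RefinesTo : Vecℤ n → ℕ → Set
  RefinesTo β r = Σ (List (Vecℤ n × ℕ)) λ L → All ChainPart L × sums L ≡ β × weight L ≤ r

  singleton-refinesTo : ∀ {β r s} → ChainPart (β , r) → r ≤ s → RefinesTo β s
  singleton-refinesTo {β} {r} part r≤s =
    [ β , r ] , part ∷ [] , ⊕-identityʳ β , subst (_≤ _) (sym (ℕ.+-identityʳ r)) r≤s

  refinePart : ∀ {β r} → UnderPart (β , r) → VanishesOff (I k) β → RefinesTo β r
  refinePart (1≤r , _ , inj₁ (r≤k , β∈I)) _ = singleton-refinesTo (1≤r , r≤k , β∈I) ℕ.≤-refl
  refinePart
    (_ , _ , inj₂ (refl , inj₁ (a , b , β , γ , 1≤a , 1≤b , a+b≡1+k , β∈I , γ∈I , refl , _))) _ =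
    (β , a) ∷ (γ , b) ∷ [] ,
    (1≤a , m+n≡1+k⇒m≤k a 1≤b a+b≡1+k , β∈I) ∷ (1≤b , m+n≡1+k⇒n≤k b 1≤a a+b≡1+k , γ∈I) ∷ [] ,
    cong (β ⊕_) (⊕-identityʳ γ) ,
    ℕ.≤-reflexive (trans (cong (a ℕ.+_) (ℕ.+-identityʳ b)) a+b≡1+k)
  refinePart (_ , _ , inj₂ (refl , inj₂ (inj₁ β∈Iₖ))) _ =
    singleton-refinesTo (1≤k , ℕ.≤-refl , β∈Iₖ) (ℕ.n≤1+n k)
  refinePart (_ , _ , inj₂ (refl , inj₂ (inj₂ (j , refl)))) vanish =
    singleton-refinesTo (1≤k , ℕ.≤-refl , vanishesOff-e⇒∈ {X = I k} j vanish) (ℕ.n≤1+n k)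

  refineParts : ∀ L → All UnderPart L → VanishesOff (I k) (sums L) → RefinesTo (sums L) (weight L)
  refineParts []            []             _      = [] , [] , refl , z≤n
  refineParts ((β , r) ∷ L) (part ∷ parts) vanish
    with vanishesOff-⊕⁻ {X = I k} {u = β} {v = sums L}
           (underPart-nonNegative part) (sums-nonNegative parts) vanish
  ... | β-vanishes , L-vanishes
    with refinePart part β-vanishes | refineParts L parts L-vanishes
  ... | M , M-parts , M≡β , M≤r | N , N-parts , N≡L , N≤L =
    M ++ N , ++⁺ M-parts N-parts , trans (sums-++ M N) (cong₂ _⊕_ M≡β N≡L) ,
    subst (_≤ r + weight L) (sym (weight-++ M N)) (ℕ.+-mono-≤ M≤r N≤L)

  chain⇒under : ∀ {α s} → Decomp R (AsSet R I) k α s → Decomp R (Under R k I) (suc k) α s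
  chain⇒under (L , parts , sums≡α , weight≡s) = L , All.map lift parts , sums≡α , weight≡s
    where
    lift : ∀ {x} → ChainPart x → UnderPart x
    lift (1≤r , r≤k , β∈I) = 1≤r , ℕ.m≤n⇒m≤1+n r≤k , inj₁ (r≤k , β∈I)

  under⇒chain : ∀ {α s} → ⟨ Supp R k I ⟩ℕ α → Decomp R (Under R k I) (suc k) α s →
                ∃[ s' ] s' ≤ s × Decomp R (AsSet R I) k α s'
  under⇒chain α∈⟨supp⟩ (L , parts , sums≡α , refl)
    with refineParts L parts
           (subst (VanishesOff (I k)) (sym sums≡α) (⟨Simple∩⟩ℕ⇒vanishesOff α∈⟨supp⟩))
  ... | M , M-parts , M≡L , M≤L = weight M , M≤L , M , M-parts , trans M≡L sums≡α , refl

  light-under⇒chain : ∀ {α s} → s ≤ k → Decomp R (Under R k I) (suc k) α s →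
                      Decomp R (AsSet R I) k α s
  light-under⇒chain s≤k (L , parts , sums≡α , refl) = L , lower L parts s≤k , sums≡α , refl
    where
    lower : ∀ L → All UnderPart L → weight L ≤ k → All ChainPart L
    lower []            []                                  _ = []
    lower ((β , r) ∷ L) ((1≤r , _ , inj₁ (r≤k , β∈I)) ∷ parts) w≤k =
      (1≤r , r≤k , β∈I) ∷ lower L parts (ℕ.≤-trans (ℕ.m≤n+m (weight L) r) w≤k)
    lower ((β , r) ∷ L) ((_ , _ , inj₂ (refl , _)) ∷ _)   w≤k =
      ⊥-elim (ℕ.n≮n k (ℕ.≤-trans (ℕ.m≤m+n (suc k) (weight L)) w≤k))

lemma7 : ∀ {n} (R : IrredCrystRootSystem n) (k : ℕ) → 1 ≤ k →
    (I : Chain R) → IsGeometric R k I →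
    ∀ α → Pos R α →
    ((⟨ Supp R k I ⟩ℕ α →
       ∀ (v : Maybe ℕ) → RankIs R (Under R k I) (suc k) α v ⇔ RankIs R (AsSet R I) k α v) ×
     (∀ s → s ≤ k → RankIs R (Under R k I) (suc k) α (just s) →
       RankIs R (AsSet R I) k α (just s)))
lemma7 R k 1≤k I ((ideals , _) , _) α _ =
  (λ α∈⟨supp⟩ → rankIs-⇔ R chain⇒under (under⇒chain α∈⟨supp⟩)) ,
  (λ s s≤k → rankIs-transfer R chain⇒under (light-under⇒chain s≤k))
  where open Refinement R k 1≤k I (λ i 1≤i i≤k → proj₁ (ideals i 1≤i i≤k))
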